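{- Let $x$ be a string, let $m\ge 3$ be an integer, let $L=\lfloor m/3\rfloor$, and let $i,j$ be positions of $x$ such that $x[i\,..\,i+m-1]$ and $x[j\,..\,j+m-1]$ are factors of $x$ at Hamming distance exactly $1$. Then there exist positions $i'\in\{i,\ldots,i+m-L\}$ and $j'\in\{j,\ldots,j+m-L\}$ with $i'-i=j'-j$ and $i'\equiv 0 \pmod L$ such that $x[i'\,..\,i'+L-1]=x[j'\,..\,j'+L-1]$.
   Context: For a string $x=x[0]x[1]\cdots x[n-1]$, $x[i\,..\,j]=x[i]\cdots x[j]$ denotes the factor from position $i$ to position $j$. The Hamming distance between two strings of equal length is the number of positions at which they differ. -}

module Defs where

open import Data.Nat using (ℕ; zero; suc; _+_; _<_; _≤_)
open import Data.Nat.Properties using (_<?_)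
open import Data.Fin using (Fin; fromℕ<)
open import Data.Vec using (Vec; lookup)
open import Relation.Nullary using (Dec; yes; no)
open import Relation.Binary.Definitions using (DecidableEquality)
open import Relation.Binary.PropositionalEquality using (_≡_)

charAt : ∀ {a} {A : Set a} {n : ℕ} → Vec A n → (p : ℕ) → p < n → A
charAt x p p<n = lookup x (fromℕ< p<n)

-- Number of positions k < m (counted by the first argument) with
-- x[i+k] ≠ x[j+k]; this is the Hamming distance of the factors
-- x[i .. i+m-1] and x[j .. j+m-1] (positions out of range are never
-- reached when i+m ≤ n and j+m ≤ n).
countMismatch : ∀ {a} {A : Set a} {n : ℕ} → DecidableEquality A →
                Vec A n → ℕ → ℕ → ℕ → ℕ
countMismatch _≟_ x i j zero = zero
countMismatch {n = n} _≟_ x i j (suc k) with (i + k) <? n | (j + k) <? n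
... | yes p | yes q with charAt x (i + k) p ≟ charAt x (j + k) q
...   | yes _ = countMismatch _≟_ x i j k
...   | no  _ = suc (countMismatch _≟_ x i j k)
countMismatch _≟_ x i j (suc k) | _ | _ = countMismatch _≟_ x i j k

hamming : ∀ {a} {A : Set a} {n : ℕ} → DecidableEquality A →
          Vec A n → (i j m : ℕ) → ℕ
hamming _≟_ x i j m = countMismatch _≟_ x i j m

FactorEq : ∀ {a} {A : Set a} {n : ℕ} → Vec A n → (i j l : ℕ) → Set a
FactorEq {n = n} x i j l =
  ∀ k → (k<l : k < l) → (p : i + k < n) → (q : j + k < n) →
  charAt x (i + k) p ≡ charAt x (j + k) q

module Submission where

-- Put L = ⌊m/3⌋ ≥ 1 and let d < L be a shift making
-- i + d a multiple of L.  Since d + 2L < 3L ≤ m, the two consecutive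
-- length-L windows starting at offsets d and d + L both lie inside the
-- compared factors x[i .. i+m-1] and x[j .. j+m-1].  Each window either
-- matches completely or contains a mismatching offset; if both contained one,
-- the two (distinct) mismatches would make the Hamming distance at least 2.
-- Hence one of them, starting at offset e ∈ {d, d + L}, matches, and
-- i′ = i + e, j′ = j + e are the required positions (L ∣ i + e in both cases).

open import Defs
open import Level using (Level)
open import Data.Nat using (ℕ; _+_; _∸_; _≤_; _/_)
open import Data.Nat.Divisibility using (_∣_)
open import Data.Product using (∃₂; _×_)
open import Data.Vec using (Vec)
open import Relation.Binary.Definitions using (DecidableEquality)
open import Relation.Binary.PropositionalEquality using (_≡_)

open import Data.Nat using (zero; suc; _<_; _*_; _%_; z≤n; s≤s; NonZero; >-nonZero; >-nonZero⁻¹)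
open import Data.Nat.Properties
open import Data.Nat.DivMod using (m≡m%n+[m/n]*n; m/n*n≤m; m≥n⇒m/n>0; m%n<n)
open import Data.Nat.Divisibility using (divides; ∣m∣n⇒∣m+n; ∣-refl)
open import Data.Product using (∃; _,_; proj₁; proj₂)
open import Data.Sum using (_⊎_; inj₁; inj₂)
open import Data.Empty using (⊥-elim)
open import Relation.Nullary using (¬_; yes; no)
open import Relation.Binary.PropositionalEquality using (refl; sym; trans; cong; subst; subst₂; module ≡-Reasoning)

alignUp : ∀ i L → .{{_ : NonZero L}} → ∃ λ d → d < L × L ∣ i + d
alignUp i L with i % L | m≡m%n+[m/n]*n i L | m%n<n i L
... | zero  | i≡q*L | _   = 0 , >-nonZero⁻¹ L , divides (i / L) (trans (+-identityʳ i) i≡q*L)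
... | suc r | i≡r+q*L | r<L = L ∸ suc r , ∸-monoʳ-< {L} {suc r} {0} (s≤s z≤n) (<⇒≤ r<L) ,
      divides (suc (i / L)) rounded
  where
    open ≡-Reasoning
    rounded : i + (L ∸ suc r) ≡ suc (i / L) * L
    rounded = begin
      i + (L ∸ suc r)                     ≡⟨ cong (_+ (L ∸ suc r)) i≡r+q*L ⟩
      (suc r + i / L * L) + (L ∸ suc r)   ≡⟨ +-assoc (suc r) _ _ ⟩
      suc r + (i / L * L + (L ∸ suc r))   ≡⟨ cong (suc r +_) (+-comm (i / L * L) _) ⟩
      suc r + ((L ∸ suc r) + i / L * L)   ≡⟨ sym (+-assoc (suc r) _ _) ⟩
      (suc r + (L ∸ suc r)) + i / L * L   ≡⟨ cong (_+ i / L * L) (m+[n∸m]≡n (<⇒≤ r<L)) ⟩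
      L + i / L * L                       ∎

three-thirds≤ : ∀ m → m / 3 + (m / 3 + m / 3) ≤ m
three-thirds≤ m = subst (_≤ m) ⌊m/3⌋*3≡ (m/n*n≤m m 3)
  where
    ⌊m/3⌋*3≡ : m / 3 * 3 ≡ m / 3 + (m / 3 + m / 3)
    ⌊m/3⌋*3≡ = trans (*-comm (m / 3) 3) (cong (λ z → m / 3 + (m / 3 + z)) (+-identityʳ (m / 3)))

window-start≤ : ∀ s {e L m} → e + L ≤ m → s + e ≤ s + m ∸ L
window-start≤ s {e} {L} {m} eL≤m =
  subst (s + e ≤_) (sym (+-∸-assoc s (m+n≤o⇒n≤o e eL≤m))) (+-monoʳ-≤ s (m+n≤o⇒m≤o∸n e eL≤m))

charAt-cong : ∀ {a} {A : Set a} {n : ℕ} (x : Vec A n) {u v : ℕ} → u ≡ v →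
              (p : u < n) (q : v < n) → charAt x u p ≡ charAt x v q
charAt-cong x refl p q rewrite <-irrelevant p q = refl

module _ {a : Level} {A : Set a} (_≟_ : DecidableEquality A) {n : ℕ} (x : Vec A n) where

  Mismatch : ℕ → ℕ → Set a
  Mismatch u v = (p : u < n) (q : v < n) → ¬ (charAt x u p ≡ charAt x v q)

  countMismatch-step : ∀ i j k → countMismatch _≟_ x i j k ≤ countMismatch _≟_ x i j (suc k)
  countMismatch-step i j k with (i + k) <? n | (j + k) <? n
  ... | yes p | yes q with charAt x (i + k) p ≟ charAt x (j + k) q
  ...   | yes _ = ≤-refl
  ...   | no  _ = n≤1+n _
  countMismatch-step i j k | yes _ | no _ = ≤-refl
  countMismatch-step i j k | no _  | _    = ≤-refl

  countMismatch-mono : ∀ i j {k l} → k ≤ l → countMismatch _≟_ x i j k ≤ countMismatch _≟_ x i j l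
  countMismatch-mono i j {k} {l} k≤l =
    subst (λ z → countMismatch _≟_ x i j k ≤ countMismatch _≟_ x i j z) (m∸n+n≡m k≤l) (grow (l ∸ k))
    where
      grow : ∀ e → countMismatch _≟_ x i j k ≤ countMismatch _≟_ x i j (e + k)
      grow zero    = ≤-refl
      grow (suc e) = ≤-trans (grow e) (countMismatch-step i j (e + k))

  countMismatch-at : ∀ i j t → i + t < n → j + t < n → Mismatch (i + t) (j + t) →
                     countMismatch _≟_ x i j (suc t) ≡ suc (countMismatch _≟_ x i j t)
  countMismatch-at i j t it jt mis with (i + t) <? n | (j + t) <? n
  ... | yes p | yes q with charAt x (i + t) p ≟ charAt x (j + t) q
  ...   | yes e = ⊥-elim (mis p q e)
  ...   | no  _ = refl
  countMismatch-at i j t it jt mis | yes _ | no ¬jt = ⊥-elim (¬jt jt)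
  countMismatch-at i j t it jt mis | no ¬it | _    = ⊥-elim (¬it it)

  two-mismatches : ∀ i j m {t₁ t₂} → i + m ≤ n → j + m ≤ n → t₁ < t₂ → t₂ < m →
                   Mismatch (i + t₁) (j + t₁) → Mismatch (i + t₂) (j + t₂) →
                   2 ≤ hamming _≟_ x i j m
  two-mismatches i j m {t₁} {t₂} im jm t₁<t₂ t₂<m mis₁ mis₂ =
    ≤-trans two-at-t₂ (countMismatch-mono i j t₂<m)
    where
      bound : ∀ s {t} → s + m ≤ n → t < m → s + t < n
      bound s sm t<m = <-≤-trans (+-monoʳ-< s t<m) sm
      t₁<m : t₁ < m
      t₁<m = <-trans t₁<t₂ t₂<m
      one-by-t₂ : 1 ≤ countMismatch _≟_ x i j t₂
      one-by-t₂ = ≤-trans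
        (subst (1 ≤_) (sym (countMismatch-at i j t₁ (bound i im t₁<m) (bound j jm t₁<m) mis₁)) (s≤s z≤n))
        (countMismatch-mono i j t₁<t₂)
      two-at-t₂ : 2 ≤ countMismatch _≟_ x i j (suc t₂)
      two-at-t₂ = subst (2 ≤_) (sym (countMismatch-at i j t₂ (bound i im t₂<m) (bound j jm t₂<m) mis₂))
                        (s≤s one-by-t₂)

  last : ∀ u {l} → u + suc l ≤ n → u + l < n
  last u {l} ul = subst (_≤ n) (+-suc u l) ul

  match-or-mismatch : ∀ u v l → u + l ≤ n → v + l ≤ n →
                      FactorEq x u v l ⊎ ∃ λ k → k < l × Mismatch (u + k) (v + k)
  match-or-mismatch u v zero _ _ = inj₁ (λ k ())
  match-or-mismatch u v (suc l) ul vl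
    with match-or-mismatch u v l (≤-trans (+-monoʳ-≤ u (n≤1+n l)) ul)
                                 (≤-trans (+-monoʳ-≤ v (n≤1+n l)) vl)
  ... | inj₂ (k , k<l , mis) = inj₂ (k , m<n⇒m<1+n k<l , mis)
  ... | inj₁ eq with charAt x (u + l) (last u ul) ≟ charAt x (v + l) (last v vl)
  ...   | no ne = inj₂ (l , n<1+n l , λ p q e →
            ne (trans (charAt-cong x refl (last u ul) p) (trans e (charAt-cong x refl q (last v vl)))))
  ...   | yes e = inj₁ extended
    where
      extended : FactorEq x u v (suc l)
      extended k k<1+l p q with m<1+n⇒m<n∨m≡n k<1+l
      ... | inj₁ k<l  = eq k k<l p q
      ... | inj₂ refl = trans (charAt-cong x refl p (last u ul)) (trans e (charAt-cong x refl (last v vl) q))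

  window : ∀ i j m e l → i + m ≤ n → j + m ≤ n → e + l ≤ m →
           FactorEq x (i + e) (j + e) l ⊎ ∃ λ t → e ≤ t × t < e + l × Mismatch (i + t) (j + t)
  window i j m e l im jm el≤m
    with match-or-mismatch (i + e) (j + e) l (inside i im) (inside j jm)
    where
      inside : ∀ s → s + m ≤ n → (s + e) + l ≤ n
      inside s sm = subst (_≤ n) (sym (+-assoc s e l)) (≤-trans (+-monoʳ-≤ s el≤m) sm)
  ... | inj₁ eq = inj₁ eq
  ... | inj₂ (k , k<l , mis) =
        inj₂ (e + k , m≤m+n e k , +-monoʳ-< e k<l , subst₂ Mismatch (+-assoc i e k) (+-assoc j e k) mis)

  AlignedMatch : (m i j L : ℕ) → Set a
  AlignedMatch m i j L =
    ∃₂ λ i′ j′ →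
    (i ≤ i′ × i′ ≤ i + m ∸ L) ×
    (j ≤ j′ × j′ ≤ j + m ∸ L) ×
    (i′ ∸ i ≡ j′ ∸ j) ×
    (L ∣ i′) ×
    FactorEq x i′ j′ L

  aligned-match-at : ∀ m i j L e → e + L ≤ m → L ∣ i + e → FactorEq x (i + e) (j + e) L →
                     AlignedMatch m i j L
  aligned-match-at m i j L e eL≤m L∣i+e eq =
    i + e , j + e , (m≤m+n i e , window-start≤ i eL≤m) , (m≤m+n j e , window-start≤ j eL≤m) ,
    trans (m+n∸m≡n i e) (sym (m+n∸m≡n j e)) , L∣i+e , eq

  -- Core of the argument, for any L: if two consecutive length-L windows
  -- starting at an aligned offset d fit into factors at Hamming distance 1,
  -- one of them matches, since a mismatch in each would give distance ≥ 2.
  aligned-match : ∀ m i j L d → i + m ≤ n → j + m ≤ n → (d + L) + L ≤ m → L ∣ i + d →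
                  hamming _≟_ x i j m ≡ 1 → AlignedMatch m i j L
  aligned-match m i j L d im jm fit L∣i+d ham≡1
    with window i j m d L im jm (≤-trans (m≤m+n (d + L) L) fit) | window i j m (d + L) L im jm fit
  ... | inj₁ eq | _ = aligned-match-at m i j L d (≤-trans (m≤m+n (d + L) L) fit) L∣i+d eq
  ... | _ | inj₁ eq = aligned-match-at m i j L (d + L) fit
                        (subst (L ∣_) (+-assoc i d L) (∣m∣n⇒∣m+n L∣i+d ∣-refl)) eq
  ... | inj₂ (t₁ , _ , t₁<d+L , mis₁) | inj₂ (t₂ , d+L≤t₂ , t₂<d+2L , mis₂) =
        ⊥-elim (n≮n 1 (subst (2 ≤_) ham≡1
          (two-mismatches i j m im jm (<-≤-trans t₁<d+L d+L≤t₂) (<-≤-trans t₂<d+2L fit) mis₁ mis₂)))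

fact2 : ∀ {a : Level} {A : Set a} (_≟_ : DecidableEquality A) {n : ℕ} (x : Vec A n)
    (m i j : ℕ) → 3 ≤ m → i + m ≤ n → j + m ≤ n →
    hamming _≟_ x i j m ≡ 1 →
    ∃₂ λ i′ j′ →
    (i ≤ i′ × i′ ≤ i + m ∸ m / 3) ×
    (j ≤ j′ × j′ ≤ j + m ∸ m / 3) ×
    (i′ ∸ i ≡ j′ ∸ j) ×
    (m / 3 ∣ i′) ×
    FactorEq x i′ j′ (m / 3)
fact2 _≟_ x m i j 3≤m im jm ham≡1 =
  aligned-match _≟_ x m i j L d im jm two-windows-fit L∣i+d ham≡1
  where
    L : ℕ
    L = m / 3
    instance
      L≢0 : NonZero L
      L≢0 = >-nonZero (m≥n⇒m/n>0 3≤m)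
    d : ℕ
    d = proj₁ (alignUp i L)
    d<L : d < L
    d<L = proj₁ (proj₂ (alignUp i L))
    L∣i+d : L ∣ i + d
    L∣i+d = proj₂ (proj₂ (alignUp i L))
    two-windows-fit : (d + L) + L ≤ m
    two-windows-fit = subst (_≤ m) (sym (+-assoc d L L))
                        (≤-trans (+-monoˡ-≤ (L + L) (<⇒≤ d<L)) (three-thirds≤ m))
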